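{- Let $E\subseteq\binom{[n]}{2}$ be an edge set such that every edge of $E$ is contained in exactly one triangle of the graph $([n],E)$. Then: (1) for every $y\in Y^{\mathrm{yes}}_{\triangle}(E)$, the edge set $R_{y}(E)$ is triangle-free; (2) for every $y\in Y^{\mathrm{no}}_{\triangle}(E)$, $R_{y}(E)$ is the edge-disjoint union of $2|E|/3$ triangles; consequently $|R_{y}(E)\setminus E'|\geq|R_{y}(E)|/3$ for every triangle-free edge set $E'\subseteq\binom{[n]\times\mathbb{F}_{2}}{2}$.
   Context: For $y\in\mathbb{F}_{2}^{E}$ (coordinates $y_{ab}=y_{ba}$ indexed by edges $\{a,b\}\in E$), $R_{y}(E)=\{\{(a,t),(b,y_{ab}+t)\}:\{a,b\}\in E,\ t\in\mathbb{F}_{2}\}\subseteq\binom{[n]\times\mathbb{F}_{2}}{2}$. $Y^{\mathrm{yes}}_{\triangle}(E)$ (resp. $Y^{\mathrm{no}}_{\triangle}(E)$) is the set of $y\in\mathbb{F}_{2}^{E}$ with $y_{ab}+y_{bc}+y_{ca}=1$ (resp. $=0$) for every triangle $\{\{a,b\},\{b,c\},\{c,a\}\}\subseteq E$. -}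

module Defs where

open import Data.Nat using (ℕ; _*_; _≤_; ⌊_/2⌋)
open import Data.Bool using (Bool; true; false; _∧_; _xor_; not)
open import Data.Fin using (Fin)
open import Data.List using (List; []; _∷_; length; filterᵇ; cartesianProduct; lookup)
open import Data.List using (allFin) public
open import Data.Product using (_×_; _,_; Σ; ∃)
open import Data.Sum using (_⊎_)
open import Data.Empty using (⊥)
open import Relation.Binary.PropositionalEquality using (_≡_)

-- An edge set on a vertex type V is a Bool-valued relation; it is a genuine
-- set of 2-element subsets when it is symmetric and irreflexive.
EdgeSet : Set → Set
EdgeSet V = V → V → Bool

Sym : {V : Set} → EdgeSet V → Set
Sym {V} E = (u v : V) → E u v ≡ E v u

Irrefl : {V : Set} → EdgeSet V → Set
Irrefl {V} E = (u : V) → E u u ≡ false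

IsGraph : {V : Set} → EdgeSet V → Set
IsGraph E = Sym E × Irrefl E

-- number of edges, given a complete duplicate-free enumeration of V:
-- half the number of ordered pairs (u,v) with E u v.
edgeCount : {V : Set} → List V → EdgeSet V → ℕ
edgeCount vs E = ⌊ length (filterᵇ (λ p → E (Data.Product.proj₁ p) (Data.Product.proj₂ p)) (cartesianProduct vs vs)) /2⌋

TriangleFree : {V : Set} → EdgeSet V → Set
TriangleFree {V} E = (u v w : V) → E u v ≡ true → E v w ≡ true → E w u ≡ true → ⊥

EachEdgeInUniqueTriangle : {V : Set} → EdgeSet V → Set
EachEdgeInUniqueTriangle {V} E =
  (a b : V) → E a b ≡ true →
  Σ V (λ c → (E b c ≡ true × E c a ≡ true)
             × ((c' : V) → E b c' ≡ true → E c' a ≡ true → c' ≡ c))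

-- F₂ = Bool with xor as addition; y ∈ F₂^E as a symmetric function on pairs
-- (only its values on edges of E matter).
Labelling : ℕ → Set
Labelling n = Fin n → Fin n → Bool

SymLab : {n : ℕ} → Labelling n → Set
SymLab {n} y = (a b : Fin n) → y a b ≡ y b a

Yyes : {n : ℕ} → EdgeSet (Fin n) → Labelling n → Set
Yyes {n} E y = (a b c : Fin n) → E a b ≡ true → E b c ≡ true → E c a ≡ true →
  (y a b xor y b c) xor y c a ≡ true

Yno : {n : ℕ} → EdgeSet (Fin n) → Labelling n → Set
Yno {n} E y = (a b c : Fin n) → E a b ≡ true → E b c ≡ true → E c a ≡ true →
  (y a b xor y b c) xor y c a ≡ false

VR : ℕ → Set
VR n = Fin n × Bool

allVR : (n : ℕ) → List (VR n)
allVR n = cartesianProduct (allFin n) (false ∷ true ∷ [])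

_==ᵇ_ : Bool → Bool → Bool
s ==ᵇ t = not (s xor t)

-- R_y(E) = { {(a,t),(b,y_ab+t)} : {a,b} ∈ E, t ∈ F₂ }
R : {n : ℕ} → Labelling n → EdgeSet (Fin n) → EdgeSet (VR n)
R y E (a , s) (b , t) = E a b ∧ (t ==ᵇ (y a b xor s))

_∖_ : {V : Set} → EdgeSet V → EdgeSet V → EdgeSet V
(E ∖ F) u v = E u v ∧ not (F u v)

Triangle : Set → Set
Triangle V = V × V × V

IsTriangleIn : {V : Set} → EdgeSet V → Triangle V → Set
IsTriangleIn E (u , v , w) = E u v ≡ true × E v w ≡ true × E w u ≡ true

EdgeOf : {V : Set} → V → V → Triangle V → Set
EdgeOf p q (u , v , w) =
  ((p ≡ u × q ≡ v) ⊎ (p ≡ v × q ≡ u)) ⊎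
  (((p ≡ v × q ≡ w) ⊎ (p ≡ w × q ≡ v)) ⊎
   ((p ≡ w × q ≡ u) ⊎ (p ≡ u × q ≡ w)))

EdgeDisjointTriangleUnion : {V : Set} → EdgeSet V → List (Triangle V) → Set
EdgeDisjointTriangleUnion {V} E Ts =
  ((i : Fin (length Ts)) → IsTriangleIn E (lookup Ts i)) ×
  ((p q : V) → E p q ≡ true →
     Σ (Fin (length Ts)) (λ i → EdgeOf p q (lookup Ts i)
        × ((j : Fin (length Ts)) → EdgeOf p q (lookup Ts j) → j ≡ i)))

{-# OPTIONS --safe #-}
-- Following an edge {a,b} of R_y(E) from level t leads to level y_ab + t, so going round a
-- triangle abc of E shifts the level by y_ab + y_bc + y_ca. If this is 1 (y ∈ Y^yes), no
-- triangle of E closes up in R_y(E), which is therefore triangle-free. If it is 0 (y ∈ Y^no),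
-- each triangle of E lifts to two triangles and every edge of R_y(E) again lies in exactly one
-- triangle. A graph with that property is the edge-disjoint union of its t triangles, so it has
-- 3t edges, and a triangle-free E′ misses at least one edge of each triangle: |R ∖ E′| ≥ t.
-- Edges are counted as ordered pairs by comparing duplicate-free lists with the same members;
-- every edge of E has exactly two lifts, whence 3t = |R_y(E)| = 2|E|.
module Submission where

open import Defs
open import Data.Nat using (ℕ; _+_; _*_; _≤_; _<_; _<?_; ⌊_/2⌋; z≤n; s≤s)
open import Data.Nat.Properties
  using (*-suc; *-assoc; +-identityʳ; +-mono-≤; *-monoʳ-≤; m≤n+m; n≡⌊n+n/2⌋; ⌊n/2⌋-mono;
         ≤-refl; ≤-reflexive; ≤-trans; ≤-antisym; <⇒≤; <-cmp; <-trans; <-irrefl; module ≤-Reasoning)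
open import Data.Bool using (Bool; true; false; _∧_; _xor_; not; T?)
open import Data.Bool.Properties using (xor-assoc; xor-comm; not-¬; T-≡)
  renaming (_≟_ to _≟ᵇ_)
open import Data.Fin using (Fin; zero; suc; toℕ)
import Data.Fin.Properties as Fin
open import Data.List
  using (List; []; _∷_; _++_; length; map; concatMap; lookup; filter; filterᵇ;
         cartesianProduct; cartesianProductWith)
open import Data.List.Properties using (length-++; length-map; filter-++; tabulate-lookup)
open import Data.List.Relation.Unary.All using (All)
import Data.List.Relation.Unary.All as All
import Data.List.Relation.Unary.All.Properties as Allₚ
open import Data.List.Relation.Unary.AllPairs using (AllPairs; []; _∷_)
import Data.List.Relation.Unary.AllPairs.Properties as AllPairs
open import Data.List.Relation.Unary.Any using (here; there)
import Data.List.Relation.Unary.Any as Any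
open import Data.List.Relation.Unary.Any.Properties using (lookup-index)
open import Data.List.Relation.Unary.Unique.Propositional using (Unique)
open import Data.List.Relation.Unary.Unique.Propositional.Properties
  using (filter⁺; cartesianProduct⁺; cartesianProductWith⁺; concat⁺; allFin⁺)
open import Data.List.Relation.Binary.Disjoint.Propositional using (Disjoint)
open import Data.List.Relation.Binary.BagAndSetEquality using (_∼[_]_; set; ∼bag⇒↭)
open import Data.List.Relation.Binary.Permutation.Propositional.Properties using (↭-length)
open import Data.List.Membership.Propositional using (_∈_; find; lose)
open import Data.List.Membership.Propositional.Properties
  using (∈-filter⁺; ∈-filter⁻; ∈-cartesianProduct⁺; ∈-cartesianProductWith⁺; ∈-cartesianProductWith⁻;
         ∈-concatMap⁺; ∈-concatMap⁻; ∈-lookup; ∈-allFin)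
open import Data.List.Membership.Propositional.Properties.WithK using (unique∧set⇒bag)
open import Data.Product using (_×_; _,_; proj₁; proj₂; Σ)
open import Data.Sum using (_⊎_; inj₁; inj₂)
open import Data.Empty using (⊥-elim)
open import Function using (_∘_; _⇔_; mk⇔; Equivalence)
open import Function.Properties.Equivalence using () renaming (refl to ⇔-refl; trans to ⇔-trans; sym to ⇔-sym)
open import Data.Product.Function.NonDependent.Propositional using (_×-⇔_)
open import Relation.Nullary using (Dec)
open import Relation.Nullary.Decidable using (_×-dec_)
open import Relation.Binary.Definitions using (tri<; tri≈; tri>)
open import Relation.Binary.PropositionalEquality
  using (_≡_; _≢_; refl; sym; trans; cong; cong₂; subst; module ≡-Reasoning)

private
  variable
    A : Set

==ᵇ⇒≡ : ∀ {s t} → (s ==ᵇ t) ≡ true → s ≡ t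
==ᵇ⇒≡ {false} {false} _ = refl
==ᵇ⇒≡ {true}  {true}  _ = refl

==ᵇ-refl : ∀ s → (s ==ᵇ s) ≡ true
==ᵇ-refl false = refl
==ᵇ-refl true  = refl

==ᵇ-xor-swap : ∀ k s t → (t ==ᵇ (k xor s)) ≡ (s ==ᵇ (k xor t))
==ᵇ-xor-swap k s t = cong not (begin
  t xor (k xor s)  ≡⟨ sym (xor-assoc t k s) ⟩
  (t xor k) xor s  ≡⟨ cong (_xor s) (xor-comm t k) ⟩
  (k xor t) xor s  ≡⟨ xor-comm (k xor t) s ⟩
  s xor (k xor t)  ∎)
  where open ≡-Reasoning

xor-cycle : ∀ p q r s → r xor (q xor (p xor s)) ≡ ((p xor q) xor r) xor s
xor-cycle p q r s = begin
  r xor (q xor (p xor s))  ≡⟨ cong (r xor_) (sym (xor-assoc q p s)) ⟩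
  r xor ((q xor p) xor s)  ≡⟨ sym (xor-assoc r (q xor p) s) ⟩
  (r xor (q xor p)) xor s  ≡⟨ cong (_xor s) (xor-comm r (q xor p)) ⟩
  ((q xor p) xor r) xor s  ≡⟨ cong (λ x → (x xor r) xor s) (xor-comm q p) ⟩
  ((p xor q) xor r) xor s  ∎
  where open ≡-Reasoning

∧-≡-true : ∀ {a b} → (a ∧ b) ≡ true ⇔ (a ≡ true × b ≡ true)
∧-≡-true {true}  {true}  = mk⇔ (λ _ → refl , refl) (λ _ → refl)
∧-≡-true {true}  {false} = mk⇔ (λ ()) (λ ())
∧-≡-true {false}         = mk⇔ (λ ()) (λ ())

∈-filterᵇ : ∀ (p : A → Bool) xs {x} → x ∈ filterᵇ p xs ⇔ (x ∈ xs × p x ≡ true)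
∈-filterᵇ p xs = mk⇔
  (λ x∈ → let x∈xs , px = ∈-filter⁻ (T? ∘ p) x∈ in x∈xs , Equivalence.to T-≡ px)
  (λ (x∈xs , px) → ∈-filter⁺ (T? ∘ p) x∈xs (Equivalence.from T-≡ px))

unique∧set⇒length≡ : {xs ys : List A} → Unique xs → Unique ys → xs ∼[ set ] ys → length xs ≡ length ys
unique∧set⇒length≡ xs! ys! xs≈ys = ↭-length (∼bag⇒↭ (unique∧set⇒bag xs! ys! xs≈ys))

lookup-injective : {xs : List A} → Unique xs → ∀ {i j} → lookup xs i ≡ lookup xs j → i ≡ j
lookup-injective {xs = _ ∷ _} _          {zero}  {zero}  _  = refl
lookup-injective              (x∉ ∷ _)   {zero}  {suc j} eq = ⊥-elim (All.lookup x∉ (∈-lookup j) eq)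
lookup-injective              (x∉ ∷ _)   {suc i} {zero}  eq = ⊥-elim (All.lookup x∉ (∈-lookup i) (sym eq))
lookup-injective              (_ ∷ xs!)  {suc i} {suc j} eq = cong suc (lookup-injective xs! eq)

⌊2*n/2⌋≡n : ∀ n → ⌊ 2 * n /2⌋ ≡ n
⌊2*n/2⌋≡n n = sym (trans (n≡⌊n+n/2⌋ n) (cong (λ m → ⌊ n + m /2⌋) (sym (+-identityʳ n))))

pattern edge-uv = inj₁ (inj₁ (refl , refl))
pattern edge-vu = inj₁ (inj₂ (refl , refl))
pattern edge-vw = inj₂ (inj₁ (inj₁ (refl , refl)))
pattern edge-wv = inj₂ (inj₁ (inj₂ (refl , refl)))
pattern edge-wu = inj₂ (inj₂ (inj₁ (refl , refl)))
pattern edge-uw = inj₂ (inj₂ (inj₂ (refl , refl)))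

module _ {V : Set} where

  arcs : List V → EdgeSet V → List (V × V)
  arcs vs G = filterᵇ (λ p → G (proj₁ p) (proj₂ p)) (cartesianProduct vs vs)

  arcs-unique : ∀ {vs} → Unique vs → (G : EdgeSet V) → Unique (arcs vs G)
  arcs-unique vs! G = filter⁺ _ (cartesianProduct⁺ vs! vs!)

  ∈-arcs : ∀ {vs} → (∀ x → x ∈ vs) → ∀ {G : EdgeSet V} {p q} → (p , q) ∈ arcs vs G ⇔ G p q ≡ true
  ∈-arcs {vs} complete {G} {p} {q} = mk⇔
    (proj₂ ∘ Equivalence.to (∈-filterᵇ _ (cartesianProduct vs vs)))
    (λ pq → Equivalence.from (∈-filterᵇ _ (cartesianProduct vs vs))
                             (∈-cartesianProduct⁺ (complete p) (complete q) , pq))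

  orientations : Triangle V → List (V × V)
  orientations (u , v , w) = (u , v) ∷ (v , u) ∷ (v , w) ∷ (w , v) ∷ (w , u) ∷ (u , w) ∷ []

  ∈-orientations : ∀ {p q} T → (p , q) ∈ orientations T ⇔ EdgeOf p q T
  ∈-orientations T = mk⇔ to from
    where
    to : ∀ {p q} → (p , q) ∈ orientations T → EdgeOf p q T
    to (here refl)                                         = edge-uv
    to (there (here refl))                                 = edge-vu
    to (there (there (here refl)))                         = edge-vw
    to (there (there (there (here refl))))                 = edge-wv
    to (there (there (there (there (here refl)))))         = edge-wu
    to (there (there (there (there (there (here refl)))))) = edge-uw
    from : ∀ {p q} → EdgeOf p q T → (p , q) ∈ orientations T
    from edge-uv = here refl
    from edge-vu = there (here refl)
    from edge-vw = there (there (here refl))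
    from edge-wv = there (there (there (here refl)))
    from edge-wu = there (there (there (there (here refl))))
    from edge-uw = there (there (there (there (there (here refl)))))

  orientations-unique : ∀ {u v w} → u ≢ v → v ≢ w → w ≢ u → Unique (orientations (u , v , w))
  orientations-unique u≢v v≢w w≢u =
      (fst u≢v All.∷ fst u≢v All.∷ fst u≢w All.∷ fst u≢w All.∷ snd v≢w All.∷ All.[])
    ∷ (snd u≢w All.∷ fst v≢w All.∷ fst v≢w All.∷ fst v≢u All.∷ All.[])
    ∷ (fst v≢w All.∷ fst v≢w All.∷ fst v≢u All.∷ All.[])
    ∷ (snd v≢u All.∷ fst w≢u All.∷ All.[])
    ∷ (fst w≢u All.∷ All.[])
    ∷ All.[] ∷ []
    where
    u≢w = w≢u ∘ sym
    v≢u = u≢v ∘ sym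
    fst : ∀ {a b c d : V} → a ≢ c → (a , b) ≢ (c , d)
    fst a≢c refl = a≢c refl
    snd : ∀ {a b c d : V} → b ≢ d → (a , b) ≢ (c , d)
    snd b≢d refl = b≢d refl

  length-concatMap-orientations : (Ts : List (Triangle V)) → length (concatMap orientations Ts) ≡ 6 * length Ts
  length-concatMap-orientations []        = refl
  length-concatMap-orientations (_ ∷ Ts) =
    trans (cong (6 +_) (length-concatMap-orientations Ts)) (sym (*-suc 6 (length Ts)))

  nonEdgeᵇ : EdgeSet V → V × V → Bool
  nonEdgeᵇ F x = not (F (proj₁ x) (proj₂ x))

  triangleFree⇒nonEdge : {F : EdgeSet V} → TriangleFree F →
    ∀ u v w → F u v ≡ false ⊎ F v w ≡ false ⊎ F w u ≡ false
  triangleFree⇒nonEdge {F} F-free u v w with F u v in uv | F v w in vw | F w u in wu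
  ... | true  | true  | true  = ⊥-elim (F-free u v w uv vw wu)
  ... | false | _     | _     = inj₁ refl
  ... | true  | false | _     = inj₂ (inj₁ refl)
  ... | true  | true  | false = inj₂ (inj₂ refl)

  2≤length-nonEdges-pair : {F : EdgeSet V} → Sym F → ∀ {a b} → F a b ≡ false →
    ∀ xs → 2 ≤ length (filterᵇ (nonEdgeᵇ F) ((a , b) ∷ (b , a) ∷ xs))
  2≤length-nonEdges-pair F-sym {a} {b} ab xs rewrite ab | trans (F-sym b a) ab = s≤s (s≤s z≤n)

  length-filterᵇ-++ʳ : (p : A → Bool) (xs ys : List A) → length (filterᵇ p ys) ≤ length (filterᵇ p (xs ++ ys))
  length-filterᵇ-++ʳ p xs ys = begin
    length (filterᵇ p ys)                          ≤⟨ m≤n+m _ _ ⟩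
    length (filterᵇ p xs) + length (filterᵇ p ys)  ≡⟨ length-++ (filterᵇ p xs) ⟨
    length (filterᵇ p xs ++ filterᵇ p ys)          ≡⟨ cong length (filter-++ (T? ∘ p) xs ys) ⟨
    length (filterᵇ p (xs ++ ys))                  ∎
    where open ≤-Reasoning

  2≤length-nonEdges-orientations : {F : EdgeSet V} → Sym F → TriangleFree F →
    ∀ T → 2 ≤ length (filterᵇ (nonEdgeᵇ F) (orientations T))
  2≤length-nonEdges-orientations {F} F-sym F-free (u , v , w) with triangleFree⇒nonEdge F-free u v w
  ... | inj₁ uv        = 2≤length-nonEdges-pair F-sym uv _
  ... | inj₂ (inj₁ vw) = ≤-trans (2≤length-nonEdges-pair F-sym vw _)
                                 (length-filterᵇ-++ʳ (nonEdgeᵇ F) ((u , v) ∷ (v , u) ∷ []) _)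
  ... | inj₂ (inj₂ wu) = ≤-trans (2≤length-nonEdges-pair F-sym wu _)
                                 (length-filterᵇ-++ʳ (nonEdgeᵇ F) ((u , v) ∷ (v , u) ∷ (v , w) ∷ (w , v) ∷ []) _)

  2*length≤length-nonEdges : {F : EdgeSet V} → Sym F → TriangleFree F →
    ∀ Ts → 2 * length Ts ≤ length (filterᵇ (nonEdgeᵇ F) (concatMap orientations Ts))
  2*length≤length-nonEdges F-sym F-free []       = z≤n
  2*length≤length-nonEdges {F} F-sym F-free (T ∷ Ts) = begin
    2 * length (T ∷ Ts)                                     ≡⟨ *-suc 2 (length Ts) ⟩
    2 + 2 * length Ts                                       ≤⟨ +-mono-≤ (2≤length-nonEdges-orientations F-sym F-free T)
                                                                       (2*length≤length-nonEdges F-sym F-free Ts) ⟩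
    length (keep (orientations T)) + length (keep rest)     ≡⟨ length-++ (keep (orientations T)) ⟨
    length (keep (orientations T) ++ keep rest)
      ≡⟨ cong length (filter-++ (T? ∘ nonEdgeᵇ F) (orientations T) rest) ⟨
    length (keep (orientations T ++ rest))                  ∎
    where
    open ≤-Reasoning
    keep : List (V × V) → List (V × V)
    keep = filterᵇ (nonEdgeᵇ F)
    rest : List (V × V)
    rest = concatMap orientations Ts

  module GraphProperties {G : EdgeSet V} (G-graph : IsGraph G) where

    flip-edge : ∀ {a b} → G a b ≡ true → G b a ≡ true
    flip-edge {a} {b} ab = trans (proj₁ G-graph b a) ab

    edge⇒≢ : ∀ {a b} → G a b ≡ true → a ≢ b
    edge⇒≢ {a} aa refl with () ← trans (sym aa) (proj₂ G-graph a)

    triangle-edge : ∀ {p q} T → IsTriangleIn G T → EdgeOf p q T → G p q ≡ true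
    triangle-edge _ (uv , _  , _ ) edge-uv = uv
    triangle-edge _ (uv , _  , _ ) edge-vu = flip-edge uv
    triangle-edge _ (_  , vw , _ ) edge-vw = vw
    triangle-edge _ (_  , vw , _ ) edge-wv = flip-edge vw
    triangle-edge _ (_  , _  , wu) edge-wu = wu
    triangle-edge _ (_  , _  , wu) edge-uw = flip-edge wu

    triangle-orientations-unique : ∀ {T} → IsTriangleIn G T → Unique (orientations T)
    triangle-orientations-unique (uv , vw , wu) = orientations-unique (edge⇒≢ uv) (edge⇒≢ vw) (edge⇒≢ wu)

module EdgeDisjointTriangleCount
  {V : Set} {vs : List V} (vs! : Unique vs) (vs-complete : ∀ x → x ∈ vs)
  {G : EdgeSet V} (G-graph : IsGraph G)
  (Ts : List (Triangle V)) (Ts-union : EdgeDisjointTriangleUnion G Ts) where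

  open GraphProperties G-graph

  triangles : All (IsTriangleIn G) Ts
  triangles = subst (All (IsTriangleIn G)) (tabulate-lookup Ts) (Allₚ.tabulate⁺ (proj₁ Ts-union))

  edge-index-unique : ∀ {p q} i j → EdgeOf p q (lookup Ts i) → EdgeOf p q (lookup Ts j) → i ≡ j
  edge-index-unique i j pq∈Ti pq∈Tj =
    let _ , _ , unique = proj₂ Ts-union _ _ (triangle-edge _ (proj₁ Ts-union i) pq∈Ti)
    in trans (unique i pq∈Ti) (sym (unique j pq∈Tj))

  orientations-disjoint : AllPairs (λ T T′ → Disjoint (orientations T) (orientations T′)) Ts
  orientations-disjoint =
    subst (AllPairs _) (tabulate-lookup Ts) (AllPairs.tabulate⁺ disjoint)
    where
    disjoint : ∀ {i j} → i ≢ j → Disjoint (orientations (lookup Ts i)) (orientations (lookup Ts j))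
    disjoint {i} {j} i≢j {_ , _} (pq∈Ti , pq∈Tj) =
      i≢j (edge-index-unique i j (Equivalence.to (∈-orientations _) pq∈Ti)
                                 (Equivalence.to (∈-orientations _) pq∈Tj))

  allArcs : List (V × V)
  allArcs = concatMap orientations Ts

  allArcs-unique : Unique allArcs
  allArcs-unique =
    concat⁺ (Allₚ.map⁺ (All.map triangle-orientations-unique triangles))
            (AllPairs.map⁺ orientations-disjoint)

  ∈-allArcs : ∀ {p q} → (p , q) ∈ allArcs ⇔ G p q ≡ true
  ∈-allArcs {p} {q} = mk⇔ to from
    where
    to : (p , q) ∈ allArcs → G p q ≡ true
    to pq∈ =
      let T , T∈Ts , pq∈T = find (∈-concatMap⁻ orientations pq∈)
      in triangle-edge T (All.lookup triangles T∈Ts) (Equivalence.to (∈-orientations T) pq∈T)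
    from : G p q ≡ true → (p , q) ∈ allArcs
    from pq =
      let i , pq∈Ti , _ = proj₂ Ts-union p q pq
      in ∈-concatMap⁺ orientations (lose (∈-lookup {xs = Ts} i) (Equivalence.from (∈-orientations _) pq∈Ti))

  length-arcs : length (arcs vs G) ≡ 2 * (3 * length Ts)
  length-arcs = begin
    length (arcs vs G)   ≡⟨ unique∧set⇒length≡ (arcs-unique vs! G) allArcs-unique
                              (λ { {_ , _} → ⇔-trans (∈-arcs vs-complete) (⇔-sym ∈-allArcs) }) ⟩
    length allArcs       ≡⟨ length-concatMap-orientations Ts ⟩
    6 * length Ts        ≡⟨ *-assoc 2 3 (length Ts) ⟩
    2 * (3 * length Ts)  ∎
    where open ≡-Reasoning

  edgeCount≡3*length : edgeCount vs G ≡ 3 * length Ts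
  edgeCount≡3*length = trans (cong ⌊_/2⌋ length-arcs) (⌊2*n/2⌋≡n _)

  length-arcs≡2*edgeCount : length (arcs vs G) ≡ 2 * edgeCount vs G
  length-arcs≡2*edgeCount = trans length-arcs (cong (2 *_) (sym edgeCount≡3*length))

  ∈-nonEdges : ∀ {F : EdgeSet V} {p q} → (p , q) ∈ filterᵇ (nonEdgeᵇ F) allArcs ⇔ (p , q) ∈ arcs vs (G ∖ F)
  ∈-nonEdges {F} =
    ⇔-trans (∈-filterᵇ (nonEdgeᵇ F) allArcs)
    (⇔-trans (∈-allArcs ×-⇔ ⇔-refl)
    (⇔-trans (⇔-sym ∧-≡-true) (⇔-sym (∈-arcs vs-complete))))

  length≤edgeCount-∖ : {F : EdgeSet V} → Sym F → TriangleFree F → length Ts ≤ edgeCount vs (G ∖ F)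
  length≤edgeCount-∖ {F} F-sym F-free = begin
    length Ts              ≡⟨ ⌊2*n/2⌋≡n (length Ts) ⟨
    ⌊ 2 * length Ts /2⌋    ≤⟨ ⌊n/2⌋-mono (≤-trans (2*length≤length-nonEdges F-sym F-free Ts)
                                                  (≤-reflexive length-nonEdges)) ⟩
    edgeCount vs (G ∖ F)   ∎
    where
    open ≤-Reasoning
    length-nonEdges : length (filterᵇ (nonEdgeᵇ F) allArcs) ≡ length (arcs vs (G ∖ F))
    length-nonEdges = unique∧set⇒length≡ (filter⁺ _ allArcs-unique) (arcs-unique vs! (G ∖ F))
                        (λ { {_ , _} → ∈-nonEdges })

module SortedTriangles
  {V : Set} {vs : List V} (vs! : Unique vs) (vs-complete : ∀ x → x ∈ vs)
  {G : EdgeSet V} (G-graph : IsGraph G) where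

  open GraphProperties G-graph

  rank : V → ℕ
  rank x = toℕ (Any.index (vs-complete x))

  rank-injective : ∀ {x y} → rank x ≡ rank y → x ≡ y
  rank-injective {x} {y} eq = begin
    x                                      ≡⟨ lookup-index (vs-complete x) ⟩
    lookup vs (Any.index (vs-complete x))  ≡⟨ cong (lookup vs) (Fin.toℕ-injective eq) ⟩
    lookup vs (Any.index (vs-complete y))  ≡⟨ lookup-index (vs-complete y) ⟨
    y                                      ∎
    where open ≡-Reasoning

  rank-≢ : ∀ {a b} → G a b ≡ true → rank a ≢ rank b
  rank-≢ ab = edge⇒≢ ab ∘ rank-injective

  -- Of the six arrangements of a triangle exactly one is Sorted, so each triangle is listed once.
  Sorted : Triangle V → Set
  Sorted (u , v , w) = rank u < rank v × rank v < rank w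

  sortedTriangle? : ∀ T → Dec (Sorted T × IsTriangleIn G T)
  sortedTriangle? (u , v , w) =
    ((rank u <? rank v) ×-dec (rank v <? rank w)) ×-dec
    ((G u v ≟ᵇ true) ×-dec (G v w ≟ᵇ true) ×-dec (G w u ≟ᵇ true))

  triples : List (Triangle V)
  triples = cartesianProduct vs (cartesianProduct vs vs)

  sortedTriangles : List (Triangle V)
  sortedTriangles = filter sortedTriangle? triples

  sortedTriangles-unique : Unique sortedTriangles
  sortedTriangles-unique = filter⁺ _ (cartesianProduct⁺ vs! (cartesianProduct⁺ vs! vs!))

  ∈-sortedTriangles⁺ : ∀ {T} → Sorted T → IsTriangleIn G T → T ∈ sortedTriangles
  ∈-sortedTriangles⁺ {u , v , w} T-sorted T-triangle =
    ∈-filter⁺ sortedTriangle?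
      (∈-cartesianProduct⁺ (vs-complete u) (∈-cartesianProduct⁺ (vs-complete v) (vs-complete w)))
      (T-sorted , T-triangle)

  ∈-sortedTriangles⁻ : ∀ {T} → T ∈ sortedTriangles → Sorted T × IsTriangleIn G T
  ∈-sortedTriangles⁻ = proj₂ ∘ ∈-filter⁻ sortedTriangle? {xs = triples}

  sortedArrangement : ∀ {p q c} → G p q ≡ true → G q c ≡ true → G c p ≡ true →
    Σ (Triangle V) (λ T → Sorted T × IsTriangleIn G T × EdgeOf p q T)
  sortedArrangement {p} {q} {c} pq qc cp with <-cmp (rank p) (rank q)
  ... | tri≈ _ p≡q _ = ⊥-elim (rank-≢ pq p≡q)
  ... | tri< p<q _ _ with <-cmp (rank q) (rank c)
  ...   | tri< q<c _ _ = (p , q , c) , (p<q , q<c) , (pq , qc , cp) , edge-uv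
  ...   | tri≈ _ q≡c _ = ⊥-elim (rank-≢ qc q≡c)
  ...   | tri> _ _ c<q with <-cmp (rank p) (rank c)
  ...     | tri< p<c _ _ = (p , c , q) , (p<c , c<q) , (flip-edge cp , flip-edge qc , flip-edge pq) , edge-uw
  ...     | tri≈ _ p≡c _ = ⊥-elim (rank-≢ cp (sym p≡c))
  ...     | tri> _ _ c<p = (c , p , q) , (c<p , p<q) , (cp , pq , qc) , edge-vw
  sortedArrangement {p} {q} {c} pq qc cp | tri> _ _ q<p with <-cmp (rank p) (rank c)
  ...   | tri< p<c _ _ = (q , p , c) , (q<p , p<c) , (flip-edge pq , flip-edge cp , flip-edge qc) , edge-vu
  ...   | tri≈ _ p≡c _ = ⊥-elim (rank-≢ cp (sym p≡c))
  ...   | tri> _ _ c<p with <-cmp (rank q) (rank c)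
  ...     | tri< q<c _ _ = (q , c , p) , (q<c , c<p) , (qc , cp , pq) , edge-wu
  ...     | tri≈ _ q≡c _ = ⊥-elim (rank-≢ qc q≡c)
  ...     | tri> _ _ c<q = (c , q , p) , (c<q , q<p) , (flip-edge qc , flip-edge pq , flip-edge cp) , edge-wv

  _∈₃_ : V → Triangle V → Set
  x ∈₃ (a , b , c) = x ≡ a ⊎ x ≡ b ⊎ x ≡ c

  pattern 1st = inj₁ refl
  pattern 2nd = inj₂ (inj₁ refl)
  pattern 3rd = inj₂ (inj₂ refl)

  _⊆₃_ : Triangle V → Triangle V → Set
  (a , b , c) ⊆₃ T = a ∈₃ T × b ∈₃ T × c ∈₃ T

  ∈₃-⊆₃ : ∀ {x} T {T′} → x ∈₃ T → T ⊆₃ T′ → x ∈₃ T′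
  ∈₃-⊆₃ (_ , _ , _) 1st (a∈ , _  , _ ) = a∈
  ∈₃-⊆₃ (_ , _ , _) 2nd (_  , b∈ , _ ) = b∈
  ∈₃-⊆₃ (_ , _ , _) 3rd (_  , _  , c∈) = c∈

  ⊆₃-trans : ∀ T {T′ T″} → T ⊆₃ T′ → T′ ⊆₃ T″ → T ⊆₃ T″
  ⊆₃-trans (_ , _ , _) {T′} (a∈ , b∈ , c∈) T′⊆ =
    ∈₃-⊆₃ T′ a∈ T′⊆ , ∈₃-⊆₃ T′ b∈ T′⊆ , ∈₃-⊆₃ T′ c∈ T′⊆

  rank-min : ∀ {a b c x} → Sorted (a , b , c) → x ∈₃ (a , b , c) → rank a ≤ rank x
  rank-min _         1st = ≤-refl
  rank-min (a<b , _) 2nd = <⇒≤ a<b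
  rank-min (a<b , b<c) 3rd = <⇒≤ (<-trans a<b b<c)

  rank-max : ∀ {a b c x} → Sorted (a , b , c) → x ∈₃ (a , b , c) → rank x ≤ rank c
  rank-max (a<b , b<c) 1st = <⇒≤ (<-trans a<b b<c)
  rank-max (_ , b<c)   2nd = <⇒≤ b<c
  rank-max _           3rd = ≤-refl

  sorted-⊆₃-antisym : ∀ {T T′} → Sorted T → Sorted T′ → T ⊆₃ T′ → T′ ⊆₃ T → T ≡ T′
  sorted-⊆₃-antisym {a , b , c} {a′ , b′ , c′} s@(a<b , b<c) s′ (a∈ , b∈ , c∈) (a′∈ , _ , c′∈) =
    cong₂ _,_ a≡a′ (cong₂ _,_ (b≡b′ b∈) c≡c′)
    where
    a≡a′ : a ≡ a′
    a≡a′ = rank-injective (≤-antisym (rank-min s a′∈) (rank-min s′ a∈))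
    c≡c′ : c ≡ c′
    c≡c′ = rank-injective (≤-antisym (rank-max s′ c∈) (rank-max s c′∈))
    b≡b′ : b ∈₃ (a′ , b′ , c′) → b ≡ b′
    b≡b′ (inj₁ b≡a′)        = ⊥-elim (<-irrefl (cong rank (trans a≡a′ (sym b≡a′))) a<b)
    b≡b′ (inj₂ (inj₁ b≡b′)) = b≡b′
    b≡b′ (inj₂ (inj₂ b≡c′)) = ⊥-elim (<-irrefl (cong rank (trans b≡c′ (sym c≡c′))) b<c)

  triangle-through-edge : ∀ {p q c T} → IsTriangleIn G T → EdgeOf p q T →
    (∀ c′ → G q c′ ≡ true → G c′ p ≡ true → c′ ≡ c) → T ⊆₃ (p , q , c) × (p , q , c) ⊆₃ T
  triangle-through-edge {T = u , v , w} (uv , vw , wu) edge-uv third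
    with refl ← third w vw wu = (1st , 2nd , 3rd) , (1st , 2nd , 3rd)
  triangle-through-edge {T = u , v , w} (uv , vw , wu) edge-vu third
    with refl ← third w (flip-edge wu) (flip-edge vw) = (2nd , 1st , 3rd) , (2nd , 1st , 3rd)
  triangle-through-edge {T = u , v , w} (uv , vw , wu) edge-vw third
    with refl ← third u wu uv = (3rd , 1st , 2nd) , (2nd , 3rd , 1st)
  triangle-through-edge {T = u , v , w} (uv , vw , wu) edge-wv third
    with refl ← third u (flip-edge uv) (flip-edge wu) = (3rd , 2nd , 1st) , (3rd , 2nd , 1st)
  triangle-through-edge {T = u , v , w} (uv , vw , wu) edge-wu third
    with refl ← third v uv vw = (2nd , 3rd , 1st) , (3rd , 1st , 2nd)
  triangle-through-edge {T = u , v , w} (uv , vw , wu) edge-uw third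
    with refl ← third v (flip-edge vw) (flip-edge uv) = (1st , 3rd , 2nd) , (1st , 3rd , 2nd)

  sorted-triangle-through-edge-unique : ∀ {p q c T T′} →
    (∀ c′ → G q c′ ≡ true → G c′ p ≡ true → c′ ≡ c) →
    Sorted T → IsTriangleIn G T → EdgeOf p q T →
    Sorted T′ → IsTriangleIn G T′ → EdgeOf p q T′ → T ≡ T′
  sorted-triangle-through-edge-unique {T = T} {T′} third
                                      T-sorted T-triangle pq∈T T′-sorted T′-triangle pq∈T′ =
    let T⊆ , ⊆T = triangle-through-edge T-triangle pq∈T third
        T′⊆ , ⊆T′ = triangle-through-edge T′-triangle pq∈T′ third
    in sorted-⊆₃-antisym T-sorted T′-sorted (⊆₃-trans T T⊆ ⊆T′) (⊆₃-trans T′ T′⊆ ⊆T)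

  decomposition : EachEdgeInUniqueTriangle G → EdgeDisjointTriangleUnion G sortedTriangles
  decomposition unique = proj₂ ∘ lookup-sorted , covering
    where
    lookup-sorted : ∀ i → Sorted (lookup sortedTriangles i) × IsTriangleIn G (lookup sortedTriangles i)
    lookup-sorted i = ∈-sortedTriangles⁻ (∈-lookup i)

    covering : ∀ p q → G p q ≡ true →
      Σ (Fin (length sortedTriangles)) (λ i → EdgeOf p q (lookup sortedTriangles i)
         × ((j : Fin (length sortedTriangles)) → EdgeOf p q (lookup sortedTriangles j) → j ≡ i))
    covering p q pq with c , (qc , cp) , third ← unique p q pq
                    with T , T-sorted , T-triangle , pq∈T ← sortedArrangement pq qc cp =
      Any.index T∈ , subst (EdgeOf p q) (lookup-index T∈) pq∈T , only
      where
      T∈ : T ∈ sortedTriangles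
      T∈ = ∈-sortedTriangles⁺ T-sorted T-triangle
      only : ∀ j → EdgeOf p q (lookup sortedTriangles j) → j ≡ Any.index T∈
      only j pq∈Tj = lookup-injective sortedTriangles-unique (trans Tj≡T (lookup-index T∈))
        where
        Tj≡T : lookup sortedTriangles j ≡ T
        Tj≡T = let Tj-sorted , Tj-triangle = lookup-sorted j in
          sorted-triangle-through-edge-unique third Tj-sorted Tj-triangle pq∈Tj T-sorted T-triangle pq∈T

bools : List Bool
bools = false ∷ true ∷ []

bools-unique : Unique bools
bools-unique = ((λ ()) All.∷ All.[]) ∷ All.[] ∷ []

∈-bools : ∀ b → b ∈ bools
∈-bools false = here refl
∈-bools true  = there (here refl)

allVR-unique : ∀ n → Unique (allVR n)
allVR-unique n = cartesianProduct⁺ (allFin⁺ n) bools-unique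

∈-allVR : ∀ {n} (x : VR n) → x ∈ allVR n
∈-allVR (a , s) = ∈-cartesianProduct⁺ (∈-allFin a) (∈-bools s)

module _ {n : ℕ} {y : Labelling n} {E : EdgeSet (Fin n)} where

  R-edge⁻ : ∀ {a s b t} → R y E (a , s) (b , t) ≡ true → E a b ≡ true × t ≡ y a b xor s
  R-edge⁻ r = let ab , t≈ = Equivalence.to ∧-≡-true r in ab , ==ᵇ⇒≡ t≈

  R-edge⁺ : ∀ {a b} s → E a b ≡ true → R y E (a , s) (b , y a b xor s) ≡ true
  R-edge⁺ {a} {b} s ab = Equivalence.from ∧-≡-true (ab , ==ᵇ-refl (y a b xor s))

  R-isGraph : SymLab y → IsGraph E → IsGraph (R y E)
  R-isGraph y-sym (E-sym , E-irrefl) = R-sym , R-irrefl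
    where
    R-sym : Sym (R y E)
    R-sym (a , s) (b , t) =
      cong₂ _∧_ (E-sym a b) (trans (==ᵇ-xor-swap (y a b) s t) (cong (λ k → s ==ᵇ (k xor t)) (y-sym a b)))
    R-irrefl : Irrefl (R y E)
    R-irrefl (a , _) = cong (_∧ _) (E-irrefl a)

  R-triangleFree : Yyes E y → TriangleFree (R y E)
  R-triangleFree odd (a , s) (b , t) (c , u) r₁ r₂ r₃
    with ab , refl ← R-edge⁻ {a} {s} {b} {t} r₁ | bc , refl ← R-edge⁻ {b} {t} {c} {u} r₂
       | ca , s≡ ← R-edge⁻ {c} {u} {a} {s} r₃ =
    not-¬ refl (begin
      s                                      ≡⟨ s≡ ⟩
      y c a xor (y b c xor (y a b xor s))    ≡⟨ xor-cycle (y a b) (y b c) (y c a) s ⟩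
      ((y a b xor y b c) xor y c a) xor s    ≡⟨ cong (_xor s) (odd a b c ab bc ca) ⟩
      not s                                  ∎)
    where open ≡-Reasoning

  R-eachEdgeInUniqueTriangle : Yno E y → EachEdgeInUniqueTriangle E → EachEdgeInUniqueTriangle (R y E)
  R-eachEdgeInUniqueTriangle even unique (a , s) (b , t) r
    with ab , refl ← R-edge⁻ {a} {s} {b} {t} r
    with c , (bc , ca) , third ← unique a b ab =
    (c , y b c xor t) , (R-edge⁺ t bc , closing) , only
    where
    cycle : y c a xor (y b c xor t) ≡ s
    cycle = trans (xor-cycle (y a b) (y b c) (y c a) s) (cong (_xor s) (even a b c ab bc ca))
    closing : R y E (c , y b c xor t) (a , s) ≡ true
    closing = subst (λ s′ → R y E (c , y b c xor t) (a , s′) ≡ true) cycle (R-edge⁺ (y b c xor t) ca)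
    only : ∀ c′ → R y E (b , t) c′ ≡ true → R y E c′ (a , s) ≡ true → c′ ≡ (c , y b c xor t)
    only (c′ , u′) r₁ r₂
      with bc′ , refl ← R-edge⁻ {b} {t} {c′} {u′} r₁ | c′a , _ ← R-edge⁻ {c′} {u′} {a} {s} r₂
      with refl ← third c′ bc′ c′a = refl

  lift : Bool → Fin n × Fin n → VR n × VR n
  lift s (a , b) = (a , s) , (b , y a b xor s)

  lifts : List (VR n × VR n)
  lifts = cartesianProductWith lift bools (arcs (allFin n) E)

  lifts-unique : Unique lifts
  lifts-unique = cartesianProductWith⁺ lift lift-injective bools-unique (arcs-unique (allFin⁺ n) E)
    where
    lift-injective : ∀ {s s′ e e′} → lift s e ≡ lift s′ e′ → s ≡ s′ × e ≡ e′
    lift-injective {e = _ , _} {_ , _} refl = refl , refl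

  ∈-lifts : ∀ {a s b t} → ((a , s) , (b , t)) ∈ lifts ⇔ R y E (a , s) (b , t) ≡ true
  ∈-lifts {a} {s} {b} {t} = mk⇔ to from
    where
    to : ((a , s) , (b , t)) ∈ lifts → R y E (a , s) (b , t) ≡ true
    to m with s′ , (_ , _) , _ , ab∈ , refl ← ∈-cartesianProductWith⁻ lift bools (arcs (allFin n) E) m =
      R-edge⁺ s′ (Equivalence.to (∈-arcs ∈-allFin) ab∈)
    from : R y E (a , s) (b , t) ≡ true → ((a , s) , (b , t)) ∈ lifts
    from r with ab , refl ← R-edge⁻ {a} {s} {b} {t} r =
      ∈-cartesianProductWith⁺ lift (∈-bools s) (Equivalence.from (∈-arcs ∈-allFin) ab)

  length-lifts : length lifts ≡ 2 * length (arcs (allFin n) E)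
  length-lifts = begin
    length (map (lift false) arcsE ++ map (lift true) arcsE ++ [])
      ≡⟨ length-++ (map (lift false) arcsE) ⟩
    length (map (lift false) arcsE) + length (map (lift true) arcsE ++ [])
      ≡⟨ cong₂ _+_ (length-map (lift false) arcsE)
                   (trans (length-++ (map (lift true) arcsE)) (cong (_+ 0) (length-map (lift true) arcsE))) ⟩
    2 * length arcsE  ∎
    where
    open ≡-Reasoning
    arcsE : List (Fin n × Fin n)
    arcsE = arcs (allFin n) E

  edgeCount-R : edgeCount (allVR n) (R y E) ≡ length (arcs (allFin n) E)
  edgeCount-R = begin
    ⌊ length (arcs (allVR n) (R y E)) /2⌋  ≡⟨ cong ⌊_/2⌋ length-arcs-R ⟩
    ⌊ length lifts /2⌋                     ≡⟨ cong ⌊_/2⌋ length-lifts ⟩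
    ⌊ 2 * length (arcs (allFin n) E) /2⌋   ≡⟨ ⌊2*n/2⌋≡n _ ⟩
    length (arcs (allFin n) E)             ∎
    where
    open ≡-Reasoning
    length-arcs-R : length (arcs (allVR n) (R y E)) ≡ length lifts
    length-arcs-R = unique∧set⇒length≡ (arcs-unique (allVR-unique n) (R y E)) lifts-unique
                      (λ { {_ , _} → ⇔-trans (∈-arcs ∈-allVR) (⇔-sym ∈-lifts) })

module _ {n : ℕ} {E : EdgeSet (Fin n)} (E-graph : IsGraph E) (E-unique : EachEdgeInUniqueTriangle E)
         {y : Labelling n} (y-sym : SymLab y) (even : Yno E y) where

  private
    R-graph : IsGraph (R y E)
    R-graph = R-isGraph y-sym E-graph
    module SortedE = SortedTriangles (allFin⁺ n) ∈-allFin E-graph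
    module SortedR = SortedTriangles (allVR-unique n) ∈-allVR R-graph
    module CountE = EdgeDisjointTriangleCount (allFin⁺ n) ∈-allFin E-graph
                      SortedE.sortedTriangles (SortedE.decomposition E-unique)
    R-union : EdgeDisjointTriangleUnion (R y E) SortedR.sortedTriangles
    R-union = SortedR.decomposition (R-eachEdgeInUniqueTriangle {y = y} even E-unique)
    module CountR = EdgeDisjointTriangleCount (allVR-unique n) ∈-allVR R-graph SortedR.sortedTriangles R-union

  R-triangleDecomposition : Σ (List (Triangle (VR n))) (λ Ts → EdgeDisjointTriangleUnion (R y E) Ts
                              × 3 * length Ts ≡ 2 * edgeCount (allFin n) E)
  R-triangleDecomposition = SortedR.sortedTriangles , R-union , (begin
    3 * length SortedR.sortedTriangles   ≡⟨ CountR.edgeCount≡3*length ⟨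
    edgeCount (allVR n) (R y E)          ≡⟨ edgeCount-R {y = y} ⟩
    length (arcs (allFin n) E)           ≡⟨ CountE.length-arcs≡2*edgeCount ⟩
    2 * edgeCount (allFin n) E           ∎)
    where open ≡-Reasoning

  R-farFromTriangleFree : (E′ : EdgeSet (VR n)) → IsGraph E′ → TriangleFree E′ →
    edgeCount (allVR n) (R y E) ≤ 3 * edgeCount (allVR n) (R y E ∖ E′)
  R-farFromTriangleFree E′ (E′-sym , _) E′-free = begin
    edgeCount (allVR n) (R y E)                ≡⟨ CountR.edgeCount≡3*length ⟩
    3 * length SortedR.sortedTriangles         ≤⟨ *-monoʳ-≤ 3 (CountR.length≤edgeCount-∖ E′-sym E′-free) ⟩
    3 * edgeCount (allVR n) (R y E ∖ E′)       ∎
    where open ≤-Reasoning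

proposition7p3 : (n : ℕ) (E : EdgeSet (Fin n)) → IsGraph E → EachEdgeInUniqueTriangle E →
      ((y : Labelling n) → SymLab y → Yyes E y → TriangleFree (R y E))
    × ((y : Labelling n) → SymLab y → Yno E y →
        Σ (List (Triangle (VR n))) (λ Ts → EdgeDisjointTriangleUnion (R y E) Ts
            × 3 * length Ts ≡ 2 * edgeCount (allFin n) E)
      × ((E' : EdgeSet (VR n)) → IsGraph E' → TriangleFree E' →
          edgeCount (allVR n) (R y E) ≤ 3 * edgeCount (allVR n) (R y E ∖ E')))
proposition7p3 n E E-graph E-unique =
    (λ y _ → R-triangleFree {y = y} {E})
  , (λ _ y-sym even → R-triangleDecomposition E-graph E-unique y-sym even
                    , R-farFromTriangleFree E-graph E-unique y-sym even)
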